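{- Let $P,P_1,\dots,P_n$ be negative propositional formulas and $A_1,\dots,A_m$ simply universal formulas, and let $\Gamma = z_1:P_1,\dots,z_n:P_n,\ a_1:\forall\alpha_1A_1,\dots,a_m:\forall\alpha_mA_m$. Suppose $\Gamma\vdash t:\exists\alpha\,P$ or $\Gamma\vdash t:P$ in $\mathsf{IL}+\mathsf{EM}_1^-$, where $t$ is in normal form and all free variables of $t$ are among $z_1,\dots,z_n,a_1,\dots,a_m$. Then: (1) every occurrence in $t$ of a term $\mathsf{H}_{a_i}^{\alpha_i A_i}$ is of the form $\mathsf{H}_{a_i}^{\alpha_i A_i}m$ for some first-order term $m$; (2) $t$ is not of the form $u\parallel_a v$.
   Context: Fix a first-order language $\mathcal{L}$; formulas are built from atomic formulas and $\bot$ with $\land,\lor,\rightarrow,\forall,\exists$, $\lnot A:=A\rightarrow\bot$. A propositional formula is quantifier-free; it is negative if $\lor$ does not occur in it; a simply universal formula is one of the form $\forall\alpha_1\dots\forall\alpha_k P$ with $P$ negative propositional. Proof terms of $\mathsf{IL}+\mathsf{EM}_1^-$: $t,u,v::= x\mid tu\mid tm\mid\lambda x.u\mid\lambda\alpha.u\mid\langle t,u\rangle\mid\pi_0u\mid\pi_1u\mid\iota_0(u)\mid\iota_1(u)\mid t[x.u,y.v]\mid(m,t)\mid t[(\alpha,x).u]\mid (u\mid v)\mid (u\parallel_a v)\mid \mathsf{H}_a^{\alpha A}\mid \mathsf{W}_a^{\alpha P}\mid \mathsf{H}_0^{P}$, with $m$ first-order terms, $x,y$ proof variables, $a$ hypothesis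 variables, $\alpha$ first-order variables, $A$ negative propositional or simply universal, $P$ negative propositional. Judgments $\Gamma\vdash t:A$, $\Gamma$ a list of distinct (proof or hypothesis) variables with formulas, are generated by the usual intuitionistic rules: $\Gamma,x:A\vdash x:A$; $\langle u,t\rangle:A\land B$ from $u:A,t:B$; $\pi_0u:A$, $\pi_1u:B$ from $u:A\land B$; $tu:B$ from $t:A\rightarrow B,u:A$; $\lambda x.u:A\rightarrow B$ from $\Gamma,x:A\vdash u:B$; $\iota_0(u):A\lor B$ from $u:A$, $\iota_1(u):A\lor B$ from $u:B$; $u[x.w_1,y.w_2]:C$ from $u:A\lor B$, $\Gamma,x:A\vdash w_1:C$, $\Gamma,y:B\vdash w_2:C$; $um:A[m/\alpha]$ from $u:\forall\alpha A$; $\lambda\alpha.u:\forall\alpha A$ from $u:A$ ($\alpha$ not free in $\Gamma$); $(m,u):\exists\alpha A$ from $u:A[m/\alpha]$; $u[(\alpha,x).t]:C$ from $u:\exists\alpha A$ and $\Gamma,x:A\vdash t:C$ ($\alpha$ not free in $C,\Gamma$); plus the axioms $\Gamma,a:\forall\alpha A\vdash\mathsf{H}_a^{\alpha A}:\forall\alpha A$; $\Gamma,a:\exists\alpha P\vdash\mathsf{W}_a^{\alpha P}:\exists\alpha P$; $\Gamma,a:P\vdash\mathsf{H}_0^P:P$; $\Gamma\vdash\mathsf{H}_0^{\bot\rightarrow P}:\bot\rightarrow P$; the rule $\mathsf{EM}_0$: from $\Gamma,a:\lnot P\vdash u:C$ and $\Gamma,a:P\vdash v:C$ ($P$ negative propositional)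 infer $\Gamma\vdash (u\mid v):C$; and the rule $\mathsf{EM}_1^-$: from $\Gamma,a:\forall\alpha P\vdash u:\exists\beta Q$ and $\Gamma,a:\exists\alpha\lnot P\vdash v:\exists\beta Q$ ($P,Q$ negative propositional) infer $\Gamma\vdash(u\parallel_a v):\exists\beta Q$; in $u\parallel_a v$ the variable $a$ is bound, its free occurrences in $u$ are all within subterms $\mathsf{H}_a^{\alpha P}$ and in $v$ within subterms $\mathsf{W}_a^{\alpha\lnot P}$. Exception substitution: $v[a:=m]$ replaces each free $\mathsf{W}_a^{\alpha\lnot P}$ in $v$ by $(m,\mathsf{H}_0^{\lnot P[m/\alpha]})$; $u[a:=m]$ replaces each subterm $\mathsf{H}_a^{\alpha P}m$ (free $a$) of $u$ by $\mathsf{H}_0^{P[m/\alpha]}$. A subterm $\mathsf{H}_a^{\alpha P}m$ is active if its only free variable is $a$. Reduction rules (applicable to any subterm): $(\lambda x.u)t\mapsto u[t/x]$; $(\lambda\alpha.u)m\mapsto u[m/\alpha]$; $\pi_i\langle u_0,u_1\rangle\mapsto u_i$; $\iota_i(u)[x_0.t_0,x_1.t_1]\mapsto t_i[u/x_i]$; $(m,u)[(\alpha,x).v]\mapsto v[m/\alpha][u/x]$; permutations $(u\mid v)w\mapsto (uw\mid vw)$ ($w$ a proof term or first-order term), $\pi_i(u\mid v)\mapsto(\pi_iu\mid\pi_iv)$, $(u\mid v)[x.w_1,y.w_2]\mapsto(u[x.w_1,y.w_2]\mid v[x.w_1,y.w_2])$, $(u\mid v)[(\alpha,x).w]\mapsto(u[(\alpha,x).w]\mid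 v[(\alpha,x).w])$; $u\parallel_a v\mapsto u$ if $a$ is not free in $u$; $u\parallel_a v\mapsto (v[a:=m]\mid (u[a:=m]\parallel_a v))$ whenever $u$ has an active subterm $\mathsf{H}_a^{\alpha P}m$. A term is in normal form if it contains no redex. -}

module Defs where

open import Data.Nat using (ℕ; zero; suc; _<_)
open import Data.Vec using (Vec; []; _∷_)
open import Data.List using (List; []; _∷_; map; _++_)
open import Data.List.Membership.Propositional using (_∈_; _∉_)
open import Data.Product using (_×_; _,_; proj₁; proj₂; Σ; ∃)
open import Data.Sum using (_⊎_)
open import Data.Empty using (⊥)
open import Data.Unit using (⊤)
open import Relation.Binary.PropositionalEquality using (_≡_; _≢_)
open import Relation.Nullary using (¬_)

record Lang : Set₁ where
  field
    Func   : Set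
    Pred   : Set
    farity : Func → ℕ
    parity : Pred → ℕ

-- First-order variables are de Bruijn indices (ℕ); binders ∀, ∃ of
-- formulas and λα, t[(α,x).u] of proof terms bind index 0.
-- Proof / hypothesis variables are names (ℕ).

module Syntax (L : Lang) where
  open Lang L

  data FTerm : Set where
    var : ℕ → FTerm
    fn  : (f : Func) → Vec FTerm (farity f) → FTerm

  infixr 6 _∧'_
  infixr 5 _∨'_
  infixr 4 _⇒'_

  data Formula : Set where
    atom : (p : Pred) → Vec FTerm (parity p) → Formula
    ⊥'   : Formula
    _∧'_ : Formula → Formula → Formula
    _∨'_ : Formula → Formula → Formula
    _⇒'_ : Formula → Formula → Formula
    ∀'   : Formula → Formula
    ∃'   : Formula → Formula

  ¬' : Formula → Formula
  ¬' A = A ⇒' ⊥'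

  liftR : (ℕ → ℕ) → ℕ → ℕ
  liftR ρ zero    = zero
  liftR ρ (suc i) = suc (ρ i)

  mutual
    renT : (ℕ → ℕ) → FTerm → FTerm
    renT ρ (var i)   = var (ρ i)
    renT ρ (fn f ts) = fn f (renTs ρ ts)

    renTs : ∀ {n} → (ℕ → ℕ) → Vec FTerm n → Vec FTerm n
    renTs ρ []       = []
    renTs ρ (t ∷ ts) = renT ρ t ∷ renTs ρ ts

  liftS : (ℕ → FTerm) → ℕ → FTerm
  liftS σ zero    = var zero
  liftS σ (suc i) = renT suc (σ i)

  mutual
    subT : (ℕ → FTerm) → FTerm → FTerm
    subT σ (var i)   = σ i
    subT σ (fn f ts) = fn f (subTs σ ts)

    subTs : ∀ {n} → (ℕ → FTerm) → Vec FTerm n → Vec FTerm n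
    subTs σ []       = []
    subTs σ (t ∷ ts) = subT σ t ∷ subTs σ ts

  renF : (ℕ → ℕ) → Formula → Formula
  renF ρ (atom p ts) = atom p (renTs ρ ts)
  renF ρ ⊥'          = ⊥'
  renF ρ (A ∧' B)    = renF ρ A ∧' renF ρ B
  renF ρ (A ∨' B)    = renF ρ A ∨' renF ρ B
  renF ρ (A ⇒' B)    = renF ρ A ⇒' renF ρ B
  renF ρ (∀' A)      = ∀' (renF (liftR ρ) A)
  renF ρ (∃' A)      = ∃' (renF (liftR ρ) A)

  subF : (ℕ → FTerm) → Formula → Formula
  subF σ (atom p ts) = atom p (subTs σ ts)
  subF σ ⊥'          = ⊥'
  subF σ (A ∧' B)    = subF σ A ∧' subF σ B
  subF σ (A ∨' B)    = subF σ A ∨' subF σ B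
  subF σ (A ⇒' B)    = subF σ A ⇒' subF σ B
  subF σ (∀' A)      = ∀' (subF (liftS σ) A)
  subF σ (∃' A)      = ∃' (subF (liftS σ) A)

  single : FTerm → ℕ → FTerm
  single m zero    = m
  single m (suc i) = var i

  _[_/0] : Formula → FTerm → Formula
  A [ m /0] = subF (single m) A

  shiftF : Formula → Formula
  shiftF = renF suc

  mutual
    ClosedT : ℕ → FTerm → Set
    ClosedT k (var i)   = i < k
    ClosedT k (fn f ts) = ClosedTs k ts

    ClosedTs : ∀ {n} → ℕ → Vec FTerm n → Set
    ClosedTs k []       = ⊤
    ClosedTs k (t ∷ ts) = ClosedT k t × ClosedTs k ts

  ClosedF : ℕ → Formula → Set
  ClosedF k (atom p ts) = ClosedTs k ts
  ClosedF k ⊥'          = ⊤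
  ClosedF k (A ∧' B)    = ClosedF k A × ClosedF k B
  ClosedF k (A ∨' B)    = ClosedF k A × ClosedF k B
  ClosedF k (A ⇒' B)    = ClosedF k A × ClosedF k B
  ClosedF k (∀' A)      = ClosedF (suc k) A
  ClosedF k (∃' A)      = ClosedF (suc k) A

  NegProp : Formula → Set
  NegProp (atom p ts) = ⊤
  NegProp ⊥'          = ⊤
  NegProp (A ∧' B)    = NegProp A × NegProp B
  NegProp (A ∨' B)    = ⊥
  NegProp (A ⇒' B)    = NegProp A × NegProp B
  NegProp (∀' A)      = ⊥
  NegProp (∃' A)      = ⊥

  data SimplyUniversal : Formula → Set where
    su-prop : ∀ {P} → NegProp P → SimplyUniversal P
    su-all  : ∀ {A} → SimplyUniversal A → SimplyUniversal (∀' A)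

  Name : Set
  Name = ℕ

  data PT : Set where
    v      : Name → PT
    app    : PT → PT → PT
    appF   : PT → FTerm → PT
    lam    : Name → PT → PT
    lamF   : PT → PT
    pair   : PT → PT → PT
    π₀ π₁  : PT → PT
    ι₀ ι₁  : PT → PT
    case   : PT → Name → PT → Name → PT → PT
    wit    : FTerm → PT → PT
    exElim : PT → Name → PT → PT                -- t[(α,x).u]  (α = index 0 in u)
    em0    : PT → PT → PT
    em1    : PT → Name → PT → PT                -- u ∥ₐ v
    H      : Name → Formula → PT                -- H_a^{αA}  (A body, α = index 0)
    W      : Name → Formula → PT
    H0     : Formula → PT

  data Sort : Set where
    pv hv : Sort

  Entry : Set
  Entry = Name × Sort × Formula

  Ctx : Set
  Ctx = List Entry

  names : Ctx → List Name
  names = map proj₁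

  shiftE : Entry → Entry
  shiftE (x , s , A) = (x , s , shiftF A)

  shiftCtx : Ctx → Ctx
  shiftCtx = map shiftE

  NegPropOrSU : Formula → Set
  NegPropOrSU A = NegProp A ⊎ SimplyUniversal A

  infix 3 _⊢_∶_

  data _⊢_∶_ : Ctx → PT → Formula → Set where
    ax   : ∀ {Γ x A} → (x , pv , A) ∈ Γ → Γ ⊢ v x ∶ A
    ∧I   : ∀ {Γ u t A B} → Γ ⊢ u ∶ A → Γ ⊢ t ∶ B → Γ ⊢ pair u t ∶ A ∧' B
    ∧E₀  : ∀ {Γ u A B} → Γ ⊢ u ∶ A ∧' B → Γ ⊢ π₀ u ∶ A
    ∧E₁  : ∀ {Γ u A B} → Γ ⊢ u ∶ A ∧' B → Γ ⊢ π₁ u ∶ B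
    ⇒E   : ∀ {Γ t u A B} → Γ ⊢ t ∶ A ⇒' B → Γ ⊢ u ∶ A → Γ ⊢ app t u ∶ B
    ⇒I   : ∀ {Γ x u A B} → x ∉ names Γ → (x , pv , A) ∷ Γ ⊢ u ∶ B →
           Γ ⊢ lam x u ∶ A ⇒' B
    ∨I₀  : ∀ {Γ u A B} → Γ ⊢ u ∶ A → Γ ⊢ ι₀ u ∶ A ∨' B
    ∨I₁  : ∀ {Γ u A B} → Γ ⊢ u ∶ B → Γ ⊢ ι₁ u ∶ A ∨' B
    ∨E   : ∀ {Γ u x w₁ y w₂ A B C} → Γ ⊢ u ∶ A ∨' B →
           x ∉ names Γ → (x , pv , A) ∷ Γ ⊢ w₁ ∶ C →
           y ∉ names Γ → (y , pv , B) ∷ Γ ⊢ w₂ ∶ C →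
           Γ ⊢ case u x w₁ y w₂ ∶ C
    ∀E   : ∀ {Γ u A} (m : FTerm) → Γ ⊢ u ∶ ∀' A → Γ ⊢ appF u m ∶ A [ m /0]
    ∀I   : ∀ {Γ u A} → shiftCtx Γ ⊢ u ∶ A → Γ ⊢ lamF u ∶ ∀' A
    ∃I   : ∀ {Γ u A} (m : FTerm) → Γ ⊢ u ∶ A [ m /0] → Γ ⊢ wit m u ∶ ∃' A
    ∃E   : ∀ {Γ u x t A C} → Γ ⊢ u ∶ ∃' A →
           x ∉ names Γ → (x , pv , A) ∷ shiftCtx Γ ⊢ t ∶ shiftF C →
           Γ ⊢ exElim u x t ∶ C
    H-ax  : ∀ {Γ a A} → NegPropOrSU A → (a , hv , ∀' A) ∈ Γ → Γ ⊢ H a A ∶ ∀' A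
    W-ax  : ∀ {Γ a P} → NegProp P → (a , hv , ∃' P) ∈ Γ → Γ ⊢ W a P ∶ ∃' P
    H0-ax : ∀ {Γ a P} → NegProp P → (a , hv , P) ∈ Γ → Γ ⊢ H0 P ∶ P
    H0-⊥  : ∀ {Γ P} → NegProp P → Γ ⊢ H0 (⊥' ⇒' P) ∶ ⊥' ⇒' P
    EM₀   : ∀ {Γ a u w P C} → NegProp P → a ∉ names Γ →
            (a , hv , ¬' P) ∷ Γ ⊢ u ∶ C → (a , hv , P) ∷ Γ ⊢ w ∶ C →
            Γ ⊢ em0 u w ∶ C
    EM₁   : ∀ {Γ a u w P Q} → NegProp P → NegProp Q → a ∉ names Γ →
            (a , hv , ∀' P) ∷ Γ ⊢ u ∶ ∃' Q →
            (a , hv , ∃' (¬' P)) ∷ Γ ⊢ w ∶ ∃' Q →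
            Γ ⊢ em1 u a w ∶ ∃' Q

  FreeIn : Name → PT → Set
  FreeIn x (v y)            = x ≡ y
  FreeIn x (app t u)        = FreeIn x t ⊎ FreeIn x u
  FreeIn x (appF t m)       = FreeIn x t
  FreeIn x (lam y u)        = x ≢ y × FreeIn x u
  FreeIn x (lamF u)         = FreeIn x u
  FreeIn x (pair t u)       = FreeIn x t ⊎ FreeIn x u
  FreeIn x (π₀ u)           = FreeIn x u
  FreeIn x (π₁ u)           = FreeIn x u
  FreeIn x (ι₀ u)           = FreeIn x u
  FreeIn x (ι₁ u)           = FreeIn x u
  FreeIn x (case u y w₁ z w₂) =
    FreeIn x u ⊎ (x ≢ y × FreeIn x w₁) ⊎ (x ≢ z × FreeIn x w₂)
  FreeIn x (wit m u)        = FreeIn x u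
  FreeIn x (exElim u y t)   = FreeIn x u ⊎ (x ≢ y × FreeIn x t)
  FreeIn x (em0 u w)        = FreeIn x u ⊎ FreeIn x w
  FreeIn x (em1 u a w)      = x ≢ a × (FreeIn x u ⊎ FreeIn x w)
  FreeIn x (H a A)          = x ≡ a
  FreeIn x (W a A)          = x ≡ a
  FreeIn x (H0 A)           = ⊥

  FOClosed : ℕ → PT → Set
  FOClosed k (v y)            = ⊤
  FOClosed k (app t u)        = FOClosed k t × FOClosed k u
  FOClosed k (appF t m)       = FOClosed k t × ClosedT k m
  FOClosed k (lam y u)        = FOClosed k u
  FOClosed k (lamF u)         = FOClosed (suc k) u
  FOClosed k (pair t u)       = FOClosed k t × FOClosed k u
  FOClosed k (π₀ u)           = FOClosed k u
  FOClosed k (π₁ u)           = FOClosed k u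
  FOClosed k (ι₀ u)           = FOClosed k u
  FOClosed k (ι₁ u)           = FOClosed k u
  FOClosed k (case u y w₁ z w₂) = FOClosed k u × FOClosed k w₁ × FOClosed k w₂
  FOClosed k (wit m u)        = ClosedT k m × FOClosed k u
  FOClosed k (exElim u y t)   = FOClosed k u × FOClosed (suc k) t
  FOClosed k (em0 u w)        = FOClosed k u × FOClosed k w
  FOClosed k (em1 u a w)      = FOClosed k u × FOClosed k w
  FOClosed k (H a A)          = ClosedF (suc k) A
  FOClosed k (W a A)          = ClosedF (suc k) A
  FOClosed k (H0 A)           = ClosedF k A

  -- Active subterms: u has an active subterm H_a^{αP} m (a free in u),
  -- i.e. one whose only free variable is a (m closed, ∀αP closed).

  HasActive : Name → PT → Set
  HasActive a (v y)            = ⊥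
  HasActive a (app t u)        = HasActive a t ⊎ HasActive a u
  HasActive a (appF (H b A) m) = b ≡ a × ClosedF 1 A × ClosedT 0 m
  HasActive a (appF t m)       = HasActive a t
  HasActive a (lam y u)        = y ≢ a × HasActive a u
  HasActive a (lamF u)         = HasActive a u
  HasActive a (pair t u)       = HasActive a t ⊎ HasActive a u
  HasActive a (π₀ u)           = HasActive a u
  HasActive a (π₁ u)           = HasActive a u
  HasActive a (ι₀ u)           = HasActive a u
  HasActive a (ι₁ u)           = HasActive a u
  HasActive a (case u y w₁ z w₂) =
    HasActive a u ⊎ (y ≢ a × HasActive a w₁) ⊎ (z ≢ a × HasActive a w₂)
  HasActive a (wit m u)        = HasActive a u
  HasActive a (exElim u y t)   = HasActive a u ⊎ (y ≢ a × HasActive a t)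
  HasActive a (em0 u w)        = HasActive a u ⊎ HasActive a w
  HasActive a (em1 u b w)      = b ≢ a × (HasActive a u ⊎ HasActive a w)
  HasActive a (H b A)          = ⊥
  HasActive a (W b A)          = ⊥
  HasActive a (H0 A)           = ⊥

  data Redex : PT → Set where
    β-λ     : ∀ {x u t} → Redex (app (lam x u) t)
    β-λF    : ∀ {u m} → Redex (appF (lamF u) m)
    β-π₀    : ∀ {u₀ u₁} → Redex (π₀ (pair u₀ u₁))
    β-π₁    : ∀ {u₀ u₁} → Redex (π₁ (pair u₀ u₁))
    β-ι₀    : ∀ {u x₀ t₀ x₁ t₁} → Redex (case (ι₀ u) x₀ t₀ x₁ t₁)
    β-ι₁    : ∀ {u x₀ t₀ x₁ t₁} → Redex (case (ι₁ u) x₀ t₀ x₁ t₁)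
    β-∃     : ∀ {m u x w} → Redex (exElim (wit m u) x w)
    p-app   : ∀ {u v' w} → Redex (app (em0 u v') w)
    p-appF  : ∀ {u v' m} → Redex (appF (em0 u v') m)
    p-π₀    : ∀ {u v'} → Redex (π₀ (em0 u v'))
    p-π₁    : ∀ {u v'} → Redex (π₁ (em0 u v'))
    p-case  : ∀ {u v' x w₁ y w₂} → Redex (case (em0 u v') x w₁ y w₂)
    p-ex    : ∀ {u v' x w} → Redex (exElim (em0 u v') x w)
    em-drop : ∀ {u a w} → ¬ FreeIn a u → Redex (em1 u a w)
    em-act  : ∀ {u a w} → HasActive a u → Redex (em1 u a w)

  Normal : PT → Set
  Normal t = ¬ Redex t × NormalSub t
    where
    NormalSub : PT → Set
    NormalSub (v y)              = ⊤
    NormalSub (app t u)          = Normal t × Normal u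
    NormalSub (appF t m)         = Normal t
    NormalSub (lam y u)          = Normal u
    NormalSub (lamF u)           = Normal u
    NormalSub (pair t u)         = Normal t × Normal u
    NormalSub (π₀ u)             = Normal u
    NormalSub (π₁ u)             = Normal u
    NormalSub (ι₀ u)             = Normal u
    NormalSub (ι₁ u)             = Normal u
    NormalSub (case u y w₁ z w₂) = Normal u × Normal w₁ × Normal w₂
    NormalSub (wit m u)          = Normal u
    NormalSub (exElim u y t)     = Normal u × Normal t
    NormalSub (em0 u w)          = Normal u × Normal w
    NormalSub (em1 u a w)        = Normal u × Normal w
    NormalSub (H b A)            = ⊤
    NormalSub (W b A)            = ⊤
    NormalSub (H0 A)             = ⊤

  OnlyApplied : Name → PT → Set
  OnlyApplied a (v y)            = ⊤
  OnlyApplied a (app t u)        = OnlyApplied a t × OnlyApplied a u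
  OnlyApplied a (appF (H b A) m) = ⊤
  OnlyApplied a (appF t m)       = OnlyApplied a t
  OnlyApplied a (lam y u)        = y ≢ a → OnlyApplied a u
  OnlyApplied a (lamF u)         = OnlyApplied a u
  OnlyApplied a (pair t u)       = OnlyApplied a t × OnlyApplied a u
  OnlyApplied a (π₀ u)           = OnlyApplied a u
  OnlyApplied a (π₁ u)           = OnlyApplied a u
  OnlyApplied a (ι₀ u)           = OnlyApplied a u
  OnlyApplied a (ι₁ u)           = OnlyApplied a u
  OnlyApplied a (case u y w₁ z w₂) =
    OnlyApplied a u × (y ≢ a → OnlyApplied a w₁) × (z ≢ a → OnlyApplied a w₂)
  OnlyApplied a (wit m u)        = OnlyApplied a u
  OnlyApplied a (exElim u y t)   = OnlyApplied a u × (y ≢ a → OnlyApplied a t)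
  OnlyApplied a (em0 u w)        = OnlyApplied a u × OnlyApplied a w
  OnlyApplied a (em1 u b w)      = b ≢ a → OnlyApplied a u × OnlyApplied a w
  OnlyApplied a (H b A)          = b ≢ a
  OnlyApplied a (W b A)          = ⊤
  OnlyApplied a (H0 A)           = ⊤

  IsEM1 : PT → Set
  IsEM1 t = Σ PT λ u → Σ Name λ a → Σ PT λ w → t ≡ em1 u a w

  mkCtx : List (Name × Formula) → List (Name × Formula) → Ctx
  mkCtx zs as = map (λ p → proj₁ p , pv , proj₂ p) zs
             ++ map (λ p → proj₁ p , hv , ∀' (proj₂ p)) as

module Submission where

open import Defs
open import Data.List using (List; _∷_; map)
open import Data.List.Relation.Unary.All using (All; _∷_; lookup)
import Data.List.Relation.Unary.All as All
open import Data.List.Relation.Unary.All.Properties using (++⁺; map⁺)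
open import Data.List.Relation.Unary.Any using (here; there)
open import Data.List.Relation.Unary.Unique.Propositional using (Unique)
open import Data.List.Membership.Propositional using (_∈_; _∉_)
open import Data.List.Membership.Propositional.Properties using (∈-map⁺)
open import Data.Product using (_×_; _,_; proj₁; proj₂; map₁)
open import Data.Sum using (_⊎_; inj₁; inj₂)
open import Data.Empty using (⊥-elim)
open import Data.Unit using (tt)
open import Relation.Nullary using (¬_)
open import Relation.Binary.PropositionalEquality using (_≢_; refl; sym; cong)

-- In a context of simply universal hypotheses, a normal term is stuck (an
-- elimination spine whose head is a variable, H_0, or H_a applied to a
-- first-order term), a bare H_a, or canonical (an introduction or an EM₀
-- split), and every stuck term has a simply universal type.  Indeed, eliminating a
-- canonical term is a redex, and ∨, ∃ never occur in a simply universal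
-- formula, so ∨E, ∃E and W_a cannot appear at all.  Following the
-- introductions down from a target type (P or ∃αP, P negative propositional)
-- one only meets stuck terms of negative propositional type, whence every
-- H_a is applied and, the applied terms being closed, every free hypothesis
-- variable has an active occurrence.  In u ∥ₐ v this makes the rule for
-- active subterms or the rule for a ∉ FV(u) applicable, so EM₁ is never normal.

module NormalForms (L : Lang) where
  open Syntax L

  NegProp-subF : ∀ σ A → NegProp A → NegProp (subF σ A)
  NegProp-subF σ (atom p ts) _       = tt
  NegProp-subF σ ⊥'          _       = tt
  NegProp-subF σ (A ∧' B)    (p , q) = NegProp-subF σ A p , NegProp-subF σ B q
  NegProp-subF σ (A ⇒' B)    (p , q) = NegProp-subF σ A p , NegProp-subF σ B q

  SimplyUniversal-subF : ∀ σ {A} → SimplyUniversal A → SimplyUniversal (subF σ A)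
  SimplyUniversal-subF σ {A} (su-prop p) = su-prop (NegProp-subF σ A p)
  SimplyUniversal-subF σ     (su-all s)  = su-all (SimplyUniversal-subF (liftS σ) s)

  NegPropOrSU⇒SimplyUniversal : ∀ {A} → NegPropOrSU A → SimplyUniversal A
  NegPropOrSU⇒SimplyUniversal (inj₁ p) = su-prop p
  NegPropOrSU⇒SimplyUniversal (inj₂ s) = s

  SimplyUniversal-∧⁻ : ∀ {A B} → SimplyUniversal (A ∧' B) → NegProp A × NegProp B
  SimplyUniversal-∧⁻ (su-prop p) = p

  SimplyUniversal-⇒⁻ : ∀ {A B} → SimplyUniversal (A ⇒' B) → NegProp A × NegProp B
  SimplyUniversal-⇒⁻ (su-prop p) = p

  SimplyUniversal-∀⁻ : ∀ {A} → SimplyUniversal (∀' A) → SimplyUniversal A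
  SimplyUniversal-∀⁻ (su-all s) = s

  ¬SimplyUniversal-∨ : ∀ {A B} → ¬ SimplyUniversal (A ∨' B)
  ¬SimplyUniversal-∨ (su-prop ())

  ¬SimplyUniversal-∃ : ∀ {A} → ¬ SimplyUniversal (∃' A)
  ¬SimplyUniversal-∃ (su-prop ())

  SimplyUniversalCtx : Ctx → Set
  SimplyUniversalCtx = All (λ e → SimplyUniversal (proj₂ (proj₂ e)))

  NotProofVar : Ctx → Name → Set
  NotProofVar Δ a = ∀ X → (a , pv , X) ∉ Δ

  NotProofVar-∷pv : ∀ {Δ a x A} → a ≢ x → NotProofVar Δ a → NotProofVar ((x , pv , A) ∷ Δ) a
  NotProofVar-∷pv a≢x nv X (here eq) = a≢x (cong proj₁ eq)
  NotProofVar-∷pv a≢x nv X (there m) = nv X m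

  NotProofVar-∷hv : ∀ {Δ a b F} → NotProofVar Δ a → NotProofVar ((b , hv , F) ∷ Δ) a
  NotProofVar-∷hv nv X (here ())
  NotProofVar-∷hv nv X (there m) = nv X m

  fresh⇒NotProofVar : ∀ {Δ a} → a ∉ names Δ → NotProofVar Δ a
  fresh⇒NotProofVar fresh X m = fresh (∈-map⁺ proj₁ m)

  data Target : Formula → Set where
    prop   : ∀ {P} → NegProp P → Target P
    ∃-prop : ∀ {P} → NegProp P → Target (∃' P)

  data Stuck : PT → Set where
    v    : ∀ {x} → Stuck (v x)
    app  : ∀ {t u} → Stuck (app t u)
    appF : ∀ {t m} → Stuck (appF t m)
    π₀   : ∀ {u} → Stuck (π₀ u)
    π₁   : ∀ {u} → Stuck (π₁ u)
    H0   : ∀ {P} → Stuck (H0 P)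

  -- EM₀ splits count as canonical: eliminating one is a permutation redex.
  data Canonical : Formula → PT → Set where
    pair : ∀ {A B u t} → Canonical (A ∧' B) (pair u t)
    lam  : ∀ {A B x u} → Canonical (A ⇒' B) (lam x u)
    ι₀   : ∀ {A B u} → Canonical (A ∨' B) (ι₀ u)
    ι₁   : ∀ {A B u} → Canonical (A ∨' B) (ι₁ u)
    lamF : ∀ {A u} → Canonical (∀' A) (lamF u)
    wit  : ∀ {A m u} → Canonical (∃' A) (wit m u)
    em0  : ∀ {C u w} → Canonical C (em0 u w)

  WellApplied : Ctx → PT → Set
  WellApplied Δ t = (∀ a → OnlyApplied a t)
                  × (∀ a → FreeIn a t → NotProofVar Δ a → HasActive a t)

  WellApplied-both : ∀ {Δ} t u → WellApplied Δ t → WellApplied Δ u →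
    (∀ a → OnlyApplied a t × OnlyApplied a u) ×
    (∀ a → FreeIn a t ⊎ FreeIn a u → NotProofVar Δ a → HasActive a t ⊎ HasActive a u)
  WellApplied-both t u (at , act) (au , acu) =
    (λ a → at a , au a) ,
    λ { a (inj₁ fr) nv → inj₁ (act a fr nv) ; a (inj₂ fr) nv → inj₂ (acu a fr nv) }

  WellApplied-lam : ∀ {Δ x A} u → WellApplied ((x , pv , A) ∷ Δ) u → WellApplied Δ (lam x u)
  WellApplied-lam u (au , acu) =
    (λ a _ → au a) ,
    λ a (a≢x , fr) nv → (λ x≡a → a≢x (sym x≡a)) , acu a fr (NotProofVar-∷pv a≢x nv)

  WellApplied-∷hv : ∀ {Δ b F} t → WellApplied ((b , hv , F) ∷ Δ) t → WellApplied Δ t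
  WellApplied-∷hv t (at , act) = at , λ a fr nv → act a fr (NotProofVar-∷hv nv)

  WellApplied-appF : ∀ {Δ s m} → Stuck s → WellApplied Δ s → WellApplied Δ (appF s m)
  WellApplied-appF v    w = w
  WellApplied-appF app  w = w
  WellApplied-appF appF w = w
  WellApplied-appF π₀   w = w
  WellApplied-appF π₁   w = w
  WellApplied-appF H0   w = w

  data Classified (Δ : Ctx) : Formula → PT → Set where
    stuck : ∀ {C t} → Stuck t → SimplyUniversal C → WellApplied Δ t → Classified Δ C t
    hyp   : ∀ {a A} → NegPropOrSU A → Classified Δ (∀' A) (H a A)
    canon : ∀ {C t} → Canonical C t → (Target C → WellApplied Δ t) → Classified Δ C t

  Classified-target : ∀ {Δ C t} → Classified Δ C t → Target C → WellApplied Δ t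
  Classified-target (stuck _ _ w) _        = w
  Classified-target (hyp _)       (prop ())
  Classified-target (canon _ w)   τ        = w τ

  non-target : ∀ {Δ C t} → Canonical C t → ¬ Target C → Classified Δ C t
  non-target c ¬τ = canon c (λ τ → ⊥-elim (¬τ τ))

  classify : ∀ {Δ t C} → SimplyUniversalCtx Δ → Δ ⊢ t ∶ C → Normal t → FOClosed 0 t →
             Classified Δ C t
  classify su (ax m) _ _ = stuck v (lookup su m) ((λ _ → tt) , λ { _ refl nv → nv _ m })
  classify su (∧I {u = u} {t = t} D E) (_ , nD , nE) (fD , fE) = canon pair target
    where
    target : Target _ → WellApplied _ (pair u t)
    target (prop (p , q)) = WellApplied-both u t (Classified-target (classify su D nD fD) (prop p))
                                             (Classified-target (classify su E nE fE) (prop q))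
  classify su (∧E₀ D) (nr , n) f with classify su D n f
  ... | stuck _ s w = stuck π₀ (su-prop (proj₁ (SimplyUniversal-∧⁻ s))) w
  ... | canon pair _ = ⊥-elim (nr β-π₀)
  ... | canon em0 _ = ⊥-elim (nr p-π₀)
  classify su (∧E₁ D) (nr , n) f with classify su D n f
  ... | stuck _ s w = stuck π₁ (su-prop (proj₂ (SimplyUniversal-∧⁻ s))) w
  ... | canon pair _ = ⊥-elim (nr β-π₁)
  ... | canon em0 _ = ⊥-elim (nr p-π₁)
  classify su (⇒E {t = t} {u = u} D E) (nr , nD , nE) (fD , fE) with classify su D nD fD
  ... | stuck _ s w =
    let (pA , pB) = SimplyUniversal-⇒⁻ s in
    stuck app (su-prop pB) (WellApplied-both t u w (Classified-target (classify su E nE fE) (prop pA)))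
  ... | canon lam _ = ⊥-elim (nr β-λ)
  ... | canon em0 _ = ⊥-elim (nr p-app)
  classify su (⇒I {x = x} {u = u} fresh D) (_ , n) f = canon lam target
    where
    target : Target _ → WellApplied _ (lam x u)
    target (prop (pA , pB)) =
      WellApplied-lam u (Classified-target (classify (su-prop pA ∷ su) D n f) (prop pB))
  classify su (∨I₀ D) _ _ = non-target ι₀ λ { (prop ()) }
  classify su (∨I₁ D) _ _ = non-target ι₁ λ { (prop ()) }
  classify su (∨E D _ _ _ _) (nr , n , _) (f , _) with classify su D n f
  ... | stuck _ s _ = ⊥-elim (¬SimplyUniversal-∨ s)
  ... | canon ι₀ _ = ⊥-elim (nr β-ι₀)
  ... | canon ι₁ _ = ⊥-elim (nr β-ι₁)
  ... | canon em0 _ = ⊥-elim (nr p-case)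
  classify su (∀E m D) (nr , n) (f , closed-m) with classify su D n f
  ... | stuck st s w =
    stuck appF (SimplyUniversal-subF (single m) (SimplyUniversal-∀⁻ s)) (WellApplied-appF st w)
  ... | hyp q =
    stuck appF (SimplyUniversal-subF (single m) (NegPropOrSU⇒SimplyUniversal q))
               ((λ _ → tt) , λ a a≡b _ → sym a≡b , f , closed-m)
  ... | canon lamF _ = ⊥-elim (nr β-λF)
  ... | canon em0 _ = ⊥-elim (nr p-appF)
  classify su (∀I D) _ _ = non-target lamF λ { (prop ()) }
  classify su (∃I {u = u} {A = A} m D) (_ , n) (_ , f) = canon wit target
    where
    target : Target (∃' A) → WellApplied _ u
    target (prop ())
    target (∃-prop p) = Classified-target (classify su D n f) (prop (NegProp-subF (single m) A p))
  classify su (∃E D _ _) (nr , n , _) (f , _) with classify su D n f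
  ... | stuck _ s _ = ⊥-elim (¬SimplyUniversal-∃ s)
  ... | canon wit _ = ⊥-elim (nr β-∃)
  ... | canon em0 _ = ⊥-elim (nr p-ex)
  classify su (H-ax q _) _ _ = hyp q
  classify su (W-ax _ m) _ _ = ⊥-elim (¬SimplyUniversal-∃ (lookup su m))
  classify su (H0-ax p _) _ _ = stuck H0 (su-prop p) ((λ _ → tt) , λ _ ())
  classify su (H0-⊥ p) _ _ = stuck H0 (su-prop (tt , p)) ((λ _ → tt) , λ _ ())
  classify su (EM₀ {u = u} {w = w} p _ D E) (_ , nD , nE) (fD , fE) = canon em0 λ τ →
    WellApplied-both u w
      (WellApplied-∷hv u (Classified-target (classify (su-prop (p , tt) ∷ su) D nD fD) τ))
      (WellApplied-∷hv w (Classified-target (classify (su-prop p ∷ su) E nE fE) τ))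
  classify su (EM₁ {a = a} {u = u} p q fresh D _) (nr , n , _) (f , _) = ⊥-elim (nr (em-drop a∉u))
    where
    a∉u : ¬ FreeIn a u
    a∉u fr = nr (em-act (proj₂ (Classified-target (classify (su-all (su-prop p) ∷ su) D n f) (∃-prop q))
                                a fr (NotProofVar-∷hv (fresh⇒NotProofVar fresh))))

  mkCtx-SimplyUniversal : ∀ zs as → All (λ p → NegProp (proj₂ p)) zs →
    All (λ p → SimplyUniversal (proj₂ p)) as → SimplyUniversalCtx (mkCtx zs as)
  mkCtx-SimplyUniversal zs as nz sa = ++⁺ (map⁺ (All.map su-prop nz)) (map⁺ (All.map su-all sa))

  Classified-¬em1 : ∀ {Δ C u a w} → ¬ Classified Δ C (em1 u a w)
  Classified-¬em1 (stuck () _ _)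
  Classified-¬em1 (canon () _)

  Classified-target-applied-¬IsEM1 : ∀ {Δ C t} → Classified Δ C t → Target C →
    (∀ a → OnlyApplied a t) × ¬ IsEM1 t
  Classified-target-applied-¬IsEM1 c τ =
    proj₁ (Classified-target c τ) , λ { (_ , _ , _ , refl) → Classified-¬em1 c }

proposition3p9 : (L : Lang) → let open Syntax L in
    (zs : List (Name × Formula)) (as : List (Name × Formula)) (P : Formula) (t : PT) →
    All (λ p → NegProp (proj₂ p)) zs →
    All (λ p → SimplyUniversal (proj₂ p)) as →
    Unique (names (mkCtx zs as)) →
    NegProp P →
    ((mkCtx zs as ⊢ t ∶ ∃' P) ⊎ (mkCtx zs as ⊢ t ∶ P)) →
    Normal t →
    (∀ x → FreeIn x t → x ∈ names (mkCtx zs as)) →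
    FOClosed 0 t →
    (∀ a → a ∈ map proj₁ as → OnlyApplied a t) × ¬ IsEM1 t
proposition3p9 L zs as P t nz sa _ nP typed n _ f =
  map₁ (λ applied a _ → applied a) (conclusion typed)
  where
  open Syntax L
  open NormalForms L
  su : SimplyUniversalCtx (mkCtx zs as)
  su = mkCtx-SimplyUniversal zs as nz sa
  conclusion : (mkCtx zs as ⊢ t ∶ ∃' P) ⊎ (mkCtx zs as ⊢ t ∶ P) →
               (∀ a → OnlyApplied a t) × ¬ IsEM1 t
  conclusion (inj₁ D) = Classified-target-applied-¬IsEM1 (classify su D n f) (∃-prop nP)
  conclusion (inj₂ D) = Classified-target-applied-¬IsEM1 (classify su D n f) (prop nP)
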